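{- Let $X=X_2=\{\circ,\bullet\}$. The two sets of tree patterns whose complements in $\mathcal{LT}_3(X)$ are $\{\circ(1,\circ(2,3)),\ \circ(\bullet(1,2),3)\}$ and $\{\bullet(1,\bullet(2,3)),\ \bullet(\circ(1,2),3)\}$ are Wilf equivalent to each other; for each $n\ge3$, the number of trees with $n$ leaves avoiding either of these sets is the Fibonacci number $f_n$, where $f_0=0$, $f_1=1$, $f_{n+1}=f_n+f_{n-1}$.
   Context: Trees are planar rooted binary trees whose internal vertices are each labelled $\circ$ or $\bullet$ and whose leaves are labelled bijectively by $\{1,\dots,l\}$ so that, assigning to each internal vertex the minimum label of its descendant leaves, the left child of each internal vertex has a smaller assigned number than its right child. Notation: a leaf is its label, and $c(A,B)$ denotes the tree whose root is labelled $c\in\{\circ,\bullet\}$ with left subtree $A$ and right subtree $B$. $\mathcal{LT}_3(X)$ is the set of the $12$ such trees with three leaves. A subtree of $T$ is a subtree $S$ rooted at an internal vertex of $T$ such that for every internal vertex of $S$ both its children in $T$ are in $S$; its leaves carry the assigned integers and relabelling them order-preservingly by $1,\dots,l$ gives the standardisation $\mathrm{st}(S)$; $T$ avoids a set of patterns if no $\mathrm{st}(S)$ lies in the set. Two pattern sets are Wilf equivalent if for every $l$ the numbers of trees with $l$ leaves avoiding them coincide. -}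

module Defs where

open import Data.Nat using (ℕ; zero; suc; _+_; _<_; _≤?_; _⊓_)
open import Data.List using (List; []; _∷_; _++_; length; filter; applyUpTo)
open import Data.List.Relation.Binary.Permutation.Propositional using (_↭_)
open import Data.List.Relation.Unary.Unique.Propositional using (Unique)
open import Data.List.Membership.Propositional using (_∈_)
open import Data.Product using (Σ; _×_; ∃)
open import Data.Unit using (⊤)
open import Function.Bundles using (_⇔_)
open import Relation.Binary.PropositionalEquality using (_≡_; _≢_)
open import Relation.Nullary using (¬_)

data X : Set where
  ○ ● : X

data Tree : Set where
  leaf : ℕ → Tree
  node : X → Tree → Tree → Tree

leaves : Tree → List ℕ
leaves (leaf n) = n ∷ []
leaves (node _ l r) = leaves l ++ leaves r

minLabel : Tree → ℕ
minLabel (leaf n) = n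
minLabel (node _ l r) = minLabel l ⊓ minLabel r

Ordered : Tree → Set
Ordered (leaf _) = ⊤
Ordered (node _ l r) = Ordered l × Ordered r × (minLabel l < minLabel r)

Valid : ℕ → Tree → Set
Valid l t = Ordered t × (leaves t ↭ applyUpTo suc l)

-- Prefix t s : s is obtained from t by keeping a rooted upper part of t
-- (every kept internal vertex keeps both children); a vertex where we cut
-- becomes a leaf carrying its assigned number.
data Prefix : Tree → Tree → Set where
  cut  : ∀ {t} → Prefix t (leaf (minLabel t))
  keep : ∀ {c l r l′ r′} → Prefix l l′ → Prefix r r′ →
         Prefix (node c l r) (node c l′ r′)

data Subtree : Tree → Tree → Set where
  here : ∀ {c l r l′ r′} → Prefix l l′ → Prefix r r′ →
         Subtree (node c l r) (node c l′ r′)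
  inL  : ∀ {c l r s} → Subtree l s → Subtree (node c l r) s
  inR  : ∀ {c l r s} → Subtree r s → Subtree (node c l r) s

relabel : (ℕ → ℕ) → Tree → Tree
relabel f (leaf n) = leaf (f n)
relabel f (node c l r) = node c (relabel f l) (relabel f r)

-- rank of x among the list: number of entries ≤ x (labels are distinct)
rank : List ℕ → ℕ → ℕ
rank ls x = length (filter (_≤? x) ls)

st : Tree → Tree
st s = relabel (rank (leaves s)) s

Avoids : (Tree → Set) → Tree → Set
Avoids Π t = ∀ s → Subtree t s → ¬ Π (st s)

Complement3 : Tree → Tree → Tree → Set
Complement3 a b p = Valid 3 p × p ≢ a × p ≢ b

HasCount : (Tree → Set) → ℕ → Set
HasCount P k = Σ (List Tree) λ ts → Unique ts × (∀ t → (t ∈ ts) ⇔ P t) × length ts ≡ k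

AvoidCount : (Tree → Set) → ℕ → ℕ → Set
AvoidCount Π l k = HasCount (λ t → Valid l t × Avoids Π t) k

WilfEquivalent : (Tree → Set) → (Tree → Set) → Set
WilfEquivalent Π₁ Π₂ = ∀ l → ∃ λ k → AvoidCount Π₁ l k × AvoidCount Π₂ l k

fib : ℕ → ℕ
fib 0 = 0
fib 1 = 1
fib (suc (suc n)) = fib (suc n) + fib n

Π₁ : Tree → Set
Π₁ = Complement3 (node ○ (leaf 1) (node ○ (leaf 2) (leaf 3)))
                 (node ○ (node ● (leaf 1) (leaf 2)) (leaf 3))

Π₂ : Tree → Set
Π₂ = Complement3 (node ● (leaf 1) (node ● (leaf 2) (leaf 3)))
                 (node ● (node ○ (leaf 1) (leaf 2)) (leaf 3))

-- Write d for the colour other than c. Avoiding every pattern except c(1,c(2,3)) and c(d(1,2),3)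
-- is a local condition at each internal vertex: a right child that is internal forces both
-- vertices to be coloured c, and an internal left child forces the shape c(d(·,·),·) with the
-- leaves of the cherry below the right subtree. Hence a tree with n ≥ 3 leaves avoids the set
-- exactly when it is a right spine of c-vertices whose left children are single leaves or
-- d-cherries labelled by consecutive integers. Reading off the left children gives a
-- composition of n into parts 1 and 2, so there are fib n such trees, independently of c.
module Submission where

open import Defs
open import Level using (Level)
open import Data.Nat using (ℕ; zero; suc; _+_; _≤_; _<_; _≤?_; _⊓_; z≤n; s≤s)
open import Data.Nat.Properties
  using (≤-refl; ≤-trans; ≤-antisym; ≤-reflexive; <⇒≤; <⇒≱; <-trans; <-≤-trans; ≤-<-trans;
         <-cmp; n<1+n; n≤1+n; m≤n⇒m⊓n≡m; m⊓n≤m; ⊓-sel; +-mono-≤; +-monoʳ-≤; +-suc; +-identityʳ;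
         <⇒≢; 0≢1+n; m≤m+n; m⊓n≤n)
open import Data.List using (List; []; _∷_; _++_; length; applyUpTo; map)
open import Data.List.Properties using (length-map; length-++; length-applyUpTo; filter-accept; filter-reject)
open import Data.List.Membership.Propositional using (_∈_)
open import Data.List.Membership.Propositional.Properties using (∈-++⁺ˡ; ∈-++⁺ʳ; ∈-++⁻; ∈-map⁺; ∈-map⁻)
open import Data.List.Relation.Unary.Any using (here; there)
open import Data.List.Relation.Unary.All as All using ([]; _∷_)
open import Data.List.Relation.Unary.All.Properties using (++⁻ˡ; ++⁻ʳ)
open import Data.List.Relation.Unary.AllPairs using ([]; _∷_)
open import Data.List.Relation.Unary.Unique.Propositional using (Unique)
import Data.List.Relation.Unary.Unique.Propositional.Properties as Unique
open import Data.List.Relation.Binary.Disjoint.Propositional using (Disjoint)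
open import Data.List.Relation.Binary.Permutation.Propositional
  using (_↭_; ↭-refl; ↭-prep; ↭-swap; ↭-sym; ↭-reflexive; ↭⇒↭ₛ)
open import Data.List.Relation.Binary.Permutation.Propositional.Properties using (∈-resp-↭; ↭-length; drop-∷)
open import Data.Product using (Σ; ∃₂; _×_; _,_; proj₁)
open import Data.Sum using (_⊎_; inj₁; inj₂)
open import Data.Unit using (⊤; tt)
open import Data.Empty using (⊥-elim)
open import Function.Bundles using (mk⇔)
open import Relation.Binary.Definitions using (DecidableEquality; tri<; tri≈; tri>)
open import Relation.Binary.PropositionalEquality
  using (_≡_; _≢_; refl; sym; trans; cong; cong₂; subst; setoid; module ≡-Reasoning)
open import Data.List.Relation.Binary.Permutation.Setoid.Properties (setoid ℕ) using (Unique-resp-↭)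
open import Relation.Nullary using (¬_; yes; no; contradiction)
open import Relation.Nullary.Decidable using (_×-dec_)

private
  variable
    a : Level
    A : Set a

interval : ℕ → ℕ → List ℕ
interval s zero = []
interval s (suc n) = s ∷ interval (suc s) n

applyUpTo≡interval : ∀ {f : ℕ → ℕ} s n → (∀ i → f i ≡ s + i) → applyUpTo f n ≡ interval s n
applyUpTo≡interval s zero _ = refl
applyUpTo≡interval s (suc n) f≗s+ =
  cong₂ _∷_ (trans (f≗s+ 0) (+-identityʳ s))
            (applyUpTo≡interval (suc s) n (λ i → trans (f≗s+ (suc i)) (+-suc s i)))

applyUpTo-suc≡interval : ∀ n → applyUpTo suc n ≡ interval 1 n
applyUpTo-suc≡interval n = applyUpTo≡interval 1 n λ _ → refl

∈-interval⇒≤ : ∀ {x} s n → x ∈ interval s n → s ≤ x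
∈-interval⇒≤ s (suc n) (here refl) = ≤-refl
∈-interval⇒≤ s (suc n) (there x∈) = <⇒≤ (∈-interval⇒≤ (suc s) n x∈)

↭-interval-head : ∀ {x xs s n} → x ∷ xs ↭ interval s n → (∀ {y} → y ∈ xs → x ≤ y) →
                  Σ ℕ λ m → n ≡ suc m × x ≡ s × xs ↭ interval (suc s) m
↭-interval-head {n = zero} p _ = ⊥-elim (0≢1+n (sym (↭-length p)))
↭-interval-head {x} {xs} {s} {suc m} p x≤xs = m , refl , x≡s , drop-∷ (subst (λ y → y ∷ xs ↭ _) x≡s p)
  where
  x≤s : x ≤ s
  x≤s with ∈-resp-↭ (↭-sym p) (here refl)
  ... | here s≡x = ≤-reflexive (sym s≡x)
  ... | there s∈xs = x≤xs s∈xs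
  x≡s : x ≡ s
  x≡s = ≤-antisym x≤s (∈-interval⇒≤ s (suc m) (∈-resp-↭ p (here refl)))

Unique-++⁻ : ∀ (xs : List A) {ys} → Unique (xs ++ ys) → Unique xs × Unique ys × Disjoint xs ys
Unique-++⁻ [] u = [] , u , λ { (() , _) }
Unique-++⁻ (x ∷ xs) (x∉ ∷ u) with Unique-++⁻ xs u
... | uxs , uys , disjoint = ++⁻ˡ xs x∉ ∷ uxs , uys , λ where
  (here refl , v∈ys) → All.lookup (++⁻ʳ xs x∉) v∈ys refl
  (there v∈xs , v∈ys) → disjoint (v∈xs , v∈ys)

rank-∷-≤ : ∀ {x z} xs → x ≤ z → rank (x ∷ xs) z ≡ suc (rank xs z)
rank-∷-≤ xs x≤z = cong length (filter-accept (_≤? _) x≤z)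

rank-∷-> : ∀ {x z} xs → z < x → rank (x ∷ xs) z ≡ rank xs z
rank-∷-> xs z<x = cong length (filter-reject (_≤? _) (<⇒≱ z<x))

ranks-increasing : ∀ {p q r} → p < q → q < r →
                   let L = p ∷ q ∷ r ∷ [] in (rank L p , rank L q , rank L r) ≡ (1 , 2 , 3)
ranks-increasing {p} {q} {r} p<q q<r = cong₂ _,_ rank-p (cong₂ _,_ rank-q rank-r)
  where
  p<r : p < r
  p<r = <-trans p<q q<r
  rank-p : rank (p ∷ q ∷ r ∷ []) p ≡ 1
  rank-p = trans (rank-∷-≤ (q ∷ r ∷ []) (≤-refl {p}))
                 (cong suc (trans (rank-∷-> (r ∷ []) p<q) (rank-∷-> [] p<r)))
  rank-q : rank (p ∷ q ∷ r ∷ []) q ≡ 2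
  rank-q = trans (rank-∷-≤ (q ∷ r ∷ []) (<⇒≤ p<q))
                 (cong suc (trans (rank-∷-≤ (r ∷ []) (≤-refl {q})) (cong suc (rank-∷-> [] q<r))))
  rank-r : rank (p ∷ q ∷ r ∷ []) r ≡ 3
  rank-r = trans (rank-∷-≤ (q ∷ r ∷ []) (<⇒≤ p<r))
                 (cong suc (trans (rank-∷-≤ (r ∷ []) (<⇒≤ q<r)) (cong suc (rank-∷-≤ [] (≤-refl {r})))))

ranks-swapped : ∀ {p q r} → p < r → r < q →
                let L = p ∷ q ∷ r ∷ [] in (rank L p , rank L q , rank L r) ≡ (1 , 3 , 2)
ranks-swapped {p} {q} {r} p<r r<q = cong₂ _,_ rank-p (cong₂ _,_ rank-q rank-r)
  where
  p<q : p < q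
  p<q = <-trans p<r r<q
  rank-p : rank (p ∷ q ∷ r ∷ []) p ≡ 1
  rank-p = trans (rank-∷-≤ (q ∷ r ∷ []) (≤-refl {p}))
                 (cong suc (trans (rank-∷-> (r ∷ []) p<q) (rank-∷-> [] p<r)))
  rank-q : rank (p ∷ q ∷ r ∷ []) q ≡ 3
  rank-q = trans (rank-∷-≤ (q ∷ r ∷ []) (<⇒≤ p<q))
                 (cong suc (trans (rank-∷-≤ (r ∷ []) (≤-refl {q})) (cong suc (rank-∷-≤ [] (<⇒≤ r<q)))))
  rank-r : rank (p ∷ q ∷ r ∷ []) r ≡ 2
  rank-r = trans (rank-∷-≤ (q ∷ r ∷ []) (<⇒≤ p<r))
                 (cong suc (trans (rank-∷-> (r ∷ []) r<q) (rank-∷-≤ [] (≤-refl {r}))))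

rightComb leftComb : X → X → ℕ → ℕ → ℕ → Tree
rightComb x y p q r = node x (leaf p) (node y (leaf q) (leaf r))
leftComb x y p q r = node x (node y (leaf p) (leaf q)) (leaf r)

st-rightComb : ∀ {x y p q r} → p < q → q < r → st (rightComb x y p q r) ≡ rightComb x y 1 2 3
st-rightComb {x} {y} p<q q<r = cong (λ (p′ , q′ , r′) → rightComb x y p′ q′ r′) (ranks-increasing p<q q<r)

st-leftComb : ∀ {x y p q r} → p < q → q < r → st (leftComb x y p q r) ≡ leftComb x y 1 2 3
st-leftComb {x} {y} p<q q<r = cong (λ (p′ , q′ , r′) → leftComb x y p′ q′ r′) (ranks-increasing p<q q<r)

st-leftComb-swapped : ∀ {x y p q r} → p < r → r < q → st (leftComb x y p q r) ≡ leftComb x y 1 3 2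
st-leftComb-swapped {x} {y} p<r r<q =
  cong (λ (p′ , q′ , r′) → leftComb x y p′ q′ r′) (ranks-swapped p<r r<q)

rightComb-valid : ∀ x y → Valid 3 (rightComb x y 1 2 3)
rightComb-valid x y = (tt , (tt , tt , s≤s (s≤s (s≤s z≤n))) , s≤s (s≤s z≤n)) , ↭-refl

leftComb-valid : ∀ x y → Valid 3 (leftComb x y 1 2 3)
leftComb-valid x y = ((tt , tt , s≤s (s≤s z≤n)) , tt , s≤s (s≤s z≤n)) , ↭-refl

leftComb-swapped-valid : ∀ x y → Valid 3 (leftComb x y 1 3 2)
leftComb-swapped-valid x y = ((tt , tt , s≤s (s≤s z≤n)) , tt , s≤s (s≤s z≤n)) , ↭-prep 1 (↭-swap 3 2 ↭-refl)

size : Tree → ℕ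
size (leaf _) = 1
size (node _ l r) = size l + size r

1≤size : ∀ t → 1 ≤ size t
1≤size (leaf _) = s≤s z≤n
1≤size (node _ l r) = ≤-trans (1≤size l) (m≤m+n (size l) (size r))

2≤size : ∀ x l r → 2 ≤ size (node x l r)
2≤size _ l r = +-mono-≤ (1≤size l) (1≤size r)

4≤⇒≢3 : ∀ {n} → 4 ≤ n → n ≢ 3
4≤⇒≢3 (s≤s (s≤s (s≤s ()))) refl

size-relabel : ∀ f t → size (relabel f t) ≡ size t
size-relabel f (leaf _) = refl
size-relabel f (node _ l r) = cong₂ _+_ (size-relabel f l) (size-relabel f r)

length-leaves : ∀ t → length (leaves t) ≡ size t
length-leaves (leaf _) = refl
length-leaves (node _ l r) = trans (length-++ (leaves l)) (cong₂ _+_ (length-leaves l) (length-leaves r))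

valid⇒size : ∀ {n} t → Valid n t → size t ≡ n
valid⇒size {n} t (_ , p) = trans (sym (length-leaves t)) (trans (↭-length p) (length-applyUpTo suc n))

minLabel∈leaves : ∀ t → minLabel t ∈ leaves t
minLabel∈leaves (leaf _) = here refl
minLabel∈leaves (node _ l r) with ⊓-sel (minLabel l) (minLabel r)
... | inj₁ eq rewrite eq = ∈-++⁺ˡ (minLabel∈leaves l)
... | inj₂ eq rewrite eq = ∈-++⁺ʳ (leaves l) (minLabel∈leaves r)

minLabel≤ : ∀ t {x} → x ∈ leaves t → minLabel t ≤ x
minLabel≤ (leaf _) (here refl) = ≤-refl
minLabel≤ (node _ l r) x∈ with ∈-++⁻ (leaves l) x∈
... | inj₁ x∈l = ≤-trans (m⊓n≤m (minLabel l) (minLabel r)) (minLabel≤ l x∈l)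
... | inj₂ x∈r = ≤-trans (m⊓n≤n (minLabel l) (minLabel r)) (minLabel≤ r x∈r)

<minLabel⇒≤leaves : ∀ {p} t → p < minLabel t → ∀ {x} → x ∈ leaves t → p ≤ x
<minLabel⇒≤leaves t p<t x∈ = <⇒≤ (<-≤-trans p<t (minLabel≤ t x∈))

node-colour-injective : ∀ {x y l r l′ r′} → node x l r ≡ node y l′ r′ → x ≡ y
node-colour-injective refl = refl

opposite : X → X
opposite ○ = ●
opposite ● = ○

opposite-≢ : ∀ x → opposite x ≢ x
opposite-≢ ○ ()
opposite-≢ ● ()

≢⇒≡opposite : ∀ {x y} → x ≢ y → x ≡ opposite y
≢⇒≡opposite {○} {○} x≢y = contradiction refl x≢y
≢⇒≡opposite {○} {●} _ = refl
≢⇒≡opposite {●} {○} _ = refl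
≢⇒≡opposite {●} {●} x≢y = contradiction refl x≢y

_≟ₓ_ : DecidableEquality X
○ ≟ₓ ○ = yes refl
○ ≟ₓ ● = no λ ()
● ≟ₓ ○ = no λ ()
● ≟ₓ ● = yes refl

valid⇒↭interval : ∀ {n t} → Valid n t → leaves t ↭ interval 1 n
valid⇒↭interval {n} (_ , p) = subst (_ ↭_) (applyUpTo-suc≡interval n) p

valid⇒unique : ∀ {n t} → Valid n t → Unique (leaves t)
valid⇒unique {n} (_ , p) =
  Unique-resp-↭ (↭⇒↭ₛ (↭-sym p)) (Unique.applyUpTo⁺₁ suc n λ i<j _ → <⇒≢ (s≤s i<j))

-- On two leaves both cherries avoid the patterns, while fib 2 = 1.
avoiderCount : ℕ → ℕ
avoiderCount 2 = 2
avoiderCount n = fib n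

module Avoidance (c : X) where

  d : X
  d = opposite c

  d≢c : d ≢ c
  d≢c = opposite-≢ c

  Pattern : Tree → Set
  Pattern = Complement3 (rightComb c c 1 2 3) (leftComb c d 1 2 3)

  rightComb-pattern : ∀ {x y} → ¬ (x ≡ c × y ≡ c) → Pattern (rightComb x y 1 2 3)
  rightComb-pattern {x} {y} ¬cc = rightComb-valid x y , (λ { refl → ¬cc (refl , refl) }) , λ ()

  leftComb-pattern : ∀ {x y} → ¬ (x ≡ c × y ≡ d) → Pattern (leftComb x y 1 2 3)
  leftComb-pattern {x} {y} ¬cd = leftComb-valid x y , (λ ()) , λ { refl → ¬cd (refl , refl) }

  leftComb-swapped-pattern : ∀ x y → Pattern (leftComb x y 1 3 2)
  leftComb-swapped-pattern x y = leftComb-swapped-valid x y , (λ ()) , λ ()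

  RightOK : X → Tree → Set
  RightOK x (leaf _) = ⊤
  RightOK x (node y _ _) = x ≡ c × y ≡ c

  LeftOK : X → Tree → Tree → Set
  LeftOK x (leaf _) r = ⊤
  LeftOK x (node y _ l₂) r = x ≡ c × y ≡ d × minLabel l₂ < minLabel r

  LocallyAvoids : Tree → Set
  LocallyAvoids (leaf _) = ⊤
  LocallyAvoids (node x l r) = LocallyAvoids l × LocallyAvoids r × RightOK x r × LeftOK x l r

  ≢c⇒leafChildren : ∀ {x l r} → x ≢ c → LocallyAvoids (node x l r) → ∃₂ λ a b → l ≡ leaf a × r ≡ leaf b
  ≢c⇒leafChildren {l = leaf a} {leaf b} _ _ = a , b , refl , refl
  ≢c⇒leafChildren {l = leaf _} {node _ _ _} x≢c (_ , _ , (x≡c , _) , _) = contradiction x≡c x≢c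
  ≢c⇒leafChildren {l = node _ _ _} x≢c (_ , _ , _ , (x≡c , _)) = contradiction x≡c x≢c

  prefix-pair-not-pattern : ∀ {x l r l′ r′} → Ordered (node x l r) → LocallyAvoids (node x l r) →
                            Prefix l l′ → Prefix r r′ → size l′ + size r′ ≡ 3 → ¬ Pattern (st (node x l′ r′))
  prefix-pair-not-pattern {l = l} (_ , (_ , _ , r₁<r₂) , l<r) (_ , _ , (refl , refl) , _)
                          cut (keep cut cut) _ (_ , ≢rightComb , _) =
    ≢rightComb (st-rightComb (subst (minLabel l <_) (m≤n⇒m⊓n≡m (<⇒≤ r₁<r₂)) l<r) r₁<r₂)
  prefix-pair-not-pattern ((_ , _ , l₁<l₂) , _ , _) (_ , _ , _ , (refl , refl , l₂<r))
                          (keep cut cut) cut _ (_ , _ , ≢leftComb) =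
    ≢leftComb (st-leftComb l₁<l₂ l₂<r)
  prefix-pair-not-pattern _ _ cut cut ()
  prefix-pair-not-pattern _ _ cut (keep {r′ = v} (keep {c = z} {l′ = a} {r′ = b} _ _) _) e =
    contradiction e (4≤⇒≢3 (+-monoʳ-≤ 1 (+-mono-≤ (2≤size z a b) (1≤size v))))
  prefix-pair-not-pattern _ _ cut (keep {l′ = v} cut (keep {c = z} {l′ = a} {r′ = b} _ _)) e =
    contradiction e (4≤⇒≢3 (+-monoʳ-≤ 1 (+-mono-≤ (1≤size v) (2≤size z a b))))
  prefix-pair-not-pattern _ _ (keep {r′ = v} (keep {c = z} {l′ = a} {r′ = b} _ _) _) cut e =
    contradiction e (4≤⇒≢3 (+-mono-≤ (+-mono-≤ (2≤size z a b) (1≤size v)) ≤-refl))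
  prefix-pair-not-pattern _ _ (keep {l′ = v} cut (keep {c = z} {l′ = a} {r′ = b} _ _)) cut e =
    contradiction e (4≤⇒≢3 (+-mono-≤ (+-mono-≤ (1≤size v) (2≤size z a b)) ≤-refl))
  prefix-pair-not-pattern _ _ (keep {c = y} {l′ = a} {r′ = b} _ _) (keep {c = z} {l′ = a′} {r′ = b′} _ _) e =
    contradiction e (4≤⇒≢3 (+-mono-≤ (2≤size y a b) (2≤size z a′ b′)))

  locallyAvoids⇒avoids : ∀ t → Ordered t → LocallyAvoids t → Avoids Pattern t
  locallyAvoids⇒avoids (node _ l _) (ol , _) (Ll , _) s (inL s⊑l) = locallyAvoids⇒avoids l ol Ll s s⊑l
  locallyAvoids⇒avoids (node _ _ r) (_ , or , _) (_ , Lr , _) s (inR s⊑r) = locallyAvoids⇒avoids r or Lr s s⊑r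
  locallyAvoids⇒avoids (node x _ _) o L s@(node .x l′ r′) (here pl pr) isPattern =
    prefix-pair-not-pattern o L pl pr size≡3 isPattern
    where
    size≡3 : size l′ + size r′ ≡ 3
    size≡3 = trans (sym (size-relabel (rank (leaves s)) s)) (valid⇒size (st s) (proj₁ isPattern))

  avoids⇒rightOK : ∀ {x l r} → Ordered (node x l r) → Avoids Pattern (node x l r) → RightOK x r
  avoids⇒rightOK {r = leaf _} _ _ = tt
  avoids⇒rightOK {x} {l} {node y r₁ r₂} (_ , (_ , _ , r₁<r₂) , l<r) avoids with (x ≟ₓ c) ×-dec (y ≟ₓ c)
  ... | yes cc = cc
  ... | no ¬cc = contradiction (subst Pattern (sym (st-rightComb l<r₁ r₁<r₂)) (rightComb-pattern ¬cc))
                               (avoids _ (here cut (keep cut cut)))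
    where
    l<r₁ : minLabel l < minLabel r₁
    l<r₁ = subst (minLabel l <_) (m≤n⇒m⊓n≡m (<⇒≤ r₁<r₂)) l<r

  -- Distinct labels rule out min l₂ = min r, the only case not decided by a three-leaf pattern.
  avoids⇒leftOK : ∀ {x l r} → Ordered (node x l r) → Disjoint (leaves l) (leaves r) →
                  Avoids Pattern (node x l r) → LeftOK x l r
  avoids⇒leftOK {l = leaf _} _ _ _ = tt
  avoids⇒leftOK {x} {node y l₁ l₂} {r} ((_ , _ , l₁<l₂) , _ , l<r) disjoint avoids
    with <-cmp (minLabel l₂) (minLabel r)
  ... | tri≈ _ l₂≡r _ =
    contradiction (∈-++⁺ʳ (leaves l₁) (minLabel∈leaves l₂) ,
                   subst (_∈ leaves r) (sym l₂≡r) (minLabel∈leaves r))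
                  disjoint
  ... | tri> _ _ r<l₂ =
    contradiction (subst Pattern (sym (st-leftComb-swapped l₁<r r<l₂)) (leftComb-swapped-pattern x y))
                  (avoids _ (here (keep cut cut) cut))
    where
    l₁<r : minLabel l₁ < minLabel r
    l₁<r = subst (_< minLabel r) (m≤n⇒m⊓n≡m (<⇒≤ l₁<l₂)) l<r
  ... | tri< l₂<r _ _ with (x ≟ₓ c) ×-dec (y ≟ₓ d)
  ...   | yes (x≡c , y≡d) = x≡c , y≡d , l₂<r
  ...   | no ¬cd = contradiction (subst Pattern (sym (st-leftComb l₁<l₂ l₂<r)) (leftComb-pattern ¬cd))
                                 (avoids _ (here (keep cut cut) cut))

  avoids⇒locallyAvoids : ∀ t → Ordered t → Unique (leaves t) → Avoids Pattern t → LocallyAvoids t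
  avoids⇒locallyAvoids (leaf _) _ _ _ = tt
  avoids⇒locallyAvoids (node x l r) o@(ol , or , _) unique avoids with Unique-++⁻ (leaves l) unique
  ... | unique-l , unique-r , disjoint =
    avoids⇒locallyAvoids l ol unique-l (λ s s⊑l → avoids s (inL s⊑l)) ,
    avoids⇒locallyAvoids r or unique-r (λ s s⊑r → avoids s (inR s⊑r)) ,
    avoids⇒rightOK o avoids ,
    avoids⇒leftOK o disjoint avoids

  data Spine : ℕ → ℕ → Tree → Set where
    leaf   : ∀ {s} → Spine s 1 (leaf s)
    single : ∀ {s n t} → Spine (suc s) n t → Spine s (suc n) (node c (leaf s) t)
    double : ∀ {s n t} → Spine (suc (suc s)) n t →
             Spine s (suc (suc n)) (node c (node d (leaf s) (leaf (suc s))) t)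

  spine-minLabel : ∀ {s n t} → Spine s n t → minLabel t ≡ s
  spine-minLabel leaf = refl
  spine-minLabel {s} (single {t = t} sp) = begin
    s ⊓ minLabel t   ≡⟨ cong (s ⊓_) (spine-minLabel sp) ⟩
    s ⊓ suc s        ≡⟨ m≤n⇒m⊓n≡m (n≤1+n s) ⟩
    s                ∎
    where open ≡-Reasoning
  spine-minLabel {s} (double {t = t} sp) = begin
    s ⊓ suc s ⊓ minLabel t   ≡⟨ cong₂ _⊓_ (m≤n⇒m⊓n≡m (n≤1+n s)) (spine-minLabel sp) ⟩
    s ⊓ suc (suc s)          ≡⟨ m≤n⇒m⊓n≡m (<⇒≤ (<-trans (n<1+n s) (n<1+n (suc s)))) ⟩
    s                        ∎
    where open ≡-Reasoning

  spine-ordered : ∀ {s n t} → Spine s n t → Ordered t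
  spine-ordered leaf = tt
  spine-ordered (single sp) = tt , spine-ordered sp , ≤-reflexive (sym (spine-minLabel sp))
  spine-ordered {s} (double sp) =
    (tt , tt , n<1+n s) , spine-ordered sp ,
    ≤-<-trans (m⊓n≤m s (suc s)) (<-trans (n<1+n s) (≤-reflexive (sym (spine-minLabel sp))))

  spine-leaves : ∀ {s n t} → Spine s n t → leaves t ≡ interval s n
  spine-leaves leaf = refl
  spine-leaves {s} (single sp) = cong (s ∷_) (spine-leaves sp)
  spine-leaves {s} (double sp) = cong (λ xs → s ∷ suc s ∷ xs) (spine-leaves sp)

  spine-rightOK : ∀ {s n t} → Spine s n t → RightOK c t
  spine-rightOK leaf = tt
  spine-rightOK (single _) = refl , refl
  spine-rightOK (double _) = refl , refl

  spine-locallyAvoids : ∀ {s n t} → Spine s n t → LocallyAvoids t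
  spine-locallyAvoids leaf = tt
  spine-locallyAvoids (single sp) = tt , spine-locallyAvoids sp , spine-rightOK sp , tt
  spine-locallyAvoids (double sp) =
    (tt , tt , tt , tt) , spine-locallyAvoids sp , spine-rightOK sp ,
    (refl , refl , ≤-reflexive (sym (spine-minLabel sp)))

  toSpine : ∀ {s n} t → Ordered t → LocallyAvoids t → RightOK c t → leaves t ↭ interval s n → Spine s n t
  toSpine (leaf _) _ _ _ p with ↭-interval-head p (λ ())
  ... | zero , refl , refl , _ = leaf
  ... | suc _ , refl , _ , q = contradiction (↭-length q) 0≢1+n
  toSpine (node .c (leaf a) r) (_ , or , a<r) (_ , Lr , rok , _) (refl , refl) p
    with ↭-interval-head p (<minLabel⇒≤leaves r a<r)
  ... | _ , refl , refl , q = single (toSpine r or Lr rok q)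
  toSpine (node .c (node .d l₁ l₂) r) ((_ , _ , l₁<l₂) , or , _) (Ll , Lr , rok , (_ , refl , l₂<r))
          (refl , refl) p
    with ≢c⇒leafChildren d≢c Ll
  ... | a , b , refl , refl
    with ↭-interval-head p (λ { (here refl) → <⇒≤ l₁<l₂
                              ; (there x∈) → <minLabel⇒≤leaves r (<-trans l₁<l₂ l₂<r) x∈ })
  ...   | _ , refl , refl , q with ↭-interval-head q (<minLabel⇒≤leaves r l₂<r)
  ...     | _ , refl , refl , q′ = double (toSpine r or Lr rok q′)

  leafStep cherryStep : ℕ → Tree → Tree
  leafStep s = node c (leaf s)
  cherryStep s = node c (node d (leaf s) (leaf (suc s)))

  spines : ℕ → ℕ → List Tree
  spines s zero = []
  spines s (suc zero) = leaf s ∷ []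
  spines s (suc (suc n)) = map (leafStep s) (spines (suc s) (suc n)) ++ map (cherryStep s) (spines (suc (suc s)) n)

  ∈-spines⁺ : ∀ {s n t} → Spine s n t → t ∈ spines s n
  ∈-spines⁺ leaf = here refl
  ∈-spines⁺ (single {n = zero} ())
  ∈-spines⁺ (single {n = suc _} sp) = ∈-++⁺ˡ (∈-map⁺ _ (∈-spines⁺ sp))
  ∈-spines⁺ (double sp) = ∈-++⁺ʳ _ (∈-map⁺ _ (∈-spines⁺ sp))

  ∈-spines⁻ : ∀ {s} n {t} → t ∈ spines s n → Spine s n t
  ∈-spines⁻ (suc zero) (here refl) = leaf
  ∈-spines⁻ {s} (suc (suc n)) t∈ with ∈-++⁻ (map (leafStep s) (spines (suc s) (suc n))) t∈
  ... | inj₁ t∈leafSteps with ∈-map⁻ (leafStep s) t∈leafSteps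
  ...   | _ , u∈ , refl = single (∈-spines⁻ (suc n) u∈)
  ∈-spines⁻ {s} (suc (suc n)) t∈ | inj₂ t∈cherrySteps with ∈-map⁻ (cherryStep s) t∈cherrySteps
  ...   | _ , u∈ , refl = double (∈-spines⁻ n u∈)

  leafSteps-disjoint-cherrySteps : ∀ s us vs → Disjoint (map (leafStep s) us) (map (cherryStep s) vs)
  leafSteps-disjoint-cherrySteps s us vs (t∈us , t∈vs) with ∈-map⁻ _ t∈us | ∈-map⁻ _ t∈vs
  ... | _ , _ , refl | _ , _ , ()

  spines-unique : ∀ s n → Unique (spines s n)
  spines-unique s zero = []
  spines-unique s (suc zero) = [] ∷ []
  spines-unique s (suc (suc n)) =
    Unique.++⁺ (Unique.map⁺ (λ { refl → refl }) (spines-unique (suc s) (suc n)))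
               (Unique.map⁺ (λ { refl → refl }) (spines-unique (suc (suc s)) n))
               (leafSteps-disjoint-cherrySteps s _ _)

  length-spines : ∀ s n → length (spines s n) ≡ fib n
  length-spines s zero = refl
  length-spines s (suc zero) = refl
  length-spines s (suc (suc n)) = begin
    length (map (leafStep s) us ++ map (cherryStep s) vs)          ≡⟨ length-++ (map (leafStep s) us) ⟩
    length (map (leafStep s) us) + length (map (cherryStep s) vs)  ≡⟨ cong₂ _+_ (length-map _ us) (length-map _ vs) ⟩
    length us + length vs                                          ≡⟨ cong₂ _+_ (length-spines (suc s) (suc n))
                                                                                (length-spines (suc (suc s)) n) ⟩
    fib (suc n) + fib n                                            ∎
    where
    open ≡-Reasoning
    us = spines (suc s) (suc n)
    vs = spines (suc (suc s)) n

  spine⇒avoider : ∀ {n t} → Spine 1 n t → Valid n t × Avoids Pattern t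
  spine⇒avoider {n} sp =
    (spine-ordered sp , ↭-reflexive (trans (spine-leaves sp) (sym (applyUpTo-suc≡interval n)))) ,
    locallyAvoids⇒avoids _ (spine-ordered sp) (spine-locallyAvoids sp)

  cherry : Tree
  cherry = node d (leaf 1) (leaf 2)

  cherry⇒avoider : Valid 2 cherry × Avoids Pattern cherry
  cherry⇒avoider = (ordered , ↭-refl) , locallyAvoids⇒avoids cherry ordered (tt , tt , tt , tt)
    where
    ordered : Ordered cherry
    ordered = tt , tt , s≤s (s≤s z≤n)

  avoiders : ℕ → List Tree
  avoiders 2 = cherry ∷ spines 1 2
  avoiders n = spines 1 n

  spines⊆avoiders : ∀ n {t} → t ∈ spines 1 n → t ∈ avoiders n
  spines⊆avoiders 1 t∈ = t∈
  spines⊆avoiders 2 t∈ = there t∈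
  spines⊆avoiders (suc (suc (suc _))) t∈ = t∈

  ∈-avoiders⁻ : ∀ n {t} → t ∈ avoiders n → t ∈ spines 1 n ⊎ (n ≡ 2 × t ≡ cherry)
  ∈-avoiders⁻ 1 t∈ = inj₁ t∈
  ∈-avoiders⁻ 2 (here refl) = inj₂ (refl , refl)
  ∈-avoiders⁻ 2 (there t∈) = inj₁ t∈
  ∈-avoiders⁻ (suc (suc (suc _))) t∈ = inj₁ t∈

  avoiders-unique : ∀ n → Unique (avoiders n)
  avoiders-unique 0 = []
  avoiders-unique 1 = spines-unique 1 1
  avoiders-unique 2 = ((λ cherry≡ → d≢c (node-colour-injective cherry≡)) ∷ []) ∷ spines-unique 1 2
  avoiders-unique (suc (suc (suc n))) = spines-unique 1 (suc (suc (suc n)))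

  length-avoiders : ∀ n → length (avoiders n) ≡ avoiderCount n
  length-avoiders 0 = refl
  length-avoiders 1 = refl
  length-avoiders 2 = refl
  length-avoiders (suc (suc (suc n))) = length-spines 1 (suc (suc (suc n)))

  ∈avoiders⇒avoider : ∀ n {t} → t ∈ avoiders n → Valid n t × Avoids Pattern t
  ∈avoiders⇒avoider n t∈ with ∈-avoiders⁻ n t∈
  ... | inj₁ t∈spines = spine⇒avoider (∈-spines⁻ n t∈spines)
  ... | inj₂ (refl , refl) = cherry⇒avoider

  rightOK⊎cherry : ∀ t → LocallyAvoids t → RightOK c t ⊎ ∃₂ λ a b → t ≡ node d (leaf a) (leaf b)
  rightOK⊎cherry (leaf _) _ = inj₁ tt
  rightOK⊎cherry (node x l r) L with x ≟ₓ c
  ... | yes refl = inj₁ (refl , refl)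
  ... | no x≢c with ≢c⇒leafChildren x≢c L
  ...   | a , b , refl , refl = inj₂ (a , b , cong (λ y → node y (leaf a) (leaf b)) (≢⇒≡opposite x≢c))

  locallyAvoids⇒∈avoiders : ∀ n t → Ordered t → LocallyAvoids t → leaves t ↭ interval 1 n → t ∈ avoiders n
  locallyAvoids⇒∈avoiders n t o L p with rightOK⊎cherry t L
  ... | inj₁ rok = spines⊆avoiders n (∈-spines⁺ (toSpine t o L rok p))
  locallyAvoids⇒∈avoiders n _ (_ , _ , a<b) L p | inj₂ (a , b , refl)
    with ↭-interval-head p (λ { (here refl) → <⇒≤ a<b })
  ...   | _ , refl , refl , q with ↭-interval-head q (λ ())
  ...     | zero , refl , refl , _ = here refl
  ...     | suc _ , refl , _ , q′ = contradiction (↭-length q′) 0≢1+n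

  avoider⇒∈avoiders : ∀ n t → Valid n t × Avoids Pattern t → t ∈ avoiders n
  avoider⇒∈avoiders n t (v@(o , _) , avoids) =
    locallyAvoids⇒∈avoiders n t o (avoids⇒locallyAvoids t o (valid⇒unique v) avoids) (valid⇒↭interval v)

  avoidCount : ∀ n → AvoidCount Pattern n (avoiderCount n)
  avoidCount n =
    avoiders n , avoiders-unique n , (λ t → mk⇔ (∈avoiders⇒avoider n) (avoider⇒∈avoiders n t)) , length-avoiders n

mainTheorem17 : WilfEquivalent Π₁ Π₂ ×
    ((n : ℕ) → 3 ≤ n → AvoidCount Π₁ n (fib n) × AvoidCount Π₂ n (fib n))
mainTheorem17 = (λ n → avoiderCount n , avoidCount ○ n , avoidCount ● n) , fibonacci
  where
  open Avoidance using (avoidCount)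
  fibonacci : (n : ℕ) → 3 ≤ n → AvoidCount Π₁ n (fib n) × AvoidCount Π₂ n (fib n)
  fibonacci n@(suc (suc (suc _))) (s≤s (s≤s (s≤s _))) = avoidCount ○ n , avoidCount ● n
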